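{- Let $p$ be a propositional variable. None of the fragments $\mathrm{ML}_{\{\mathsf{3xor},\Diamond\}}[\{p\}]$, $\mathrm{ML}_{\{\mathsf{3xor},\Box\}}[\{p\}]$, $\mathrm{ML}_{\{\mathsf{oxor},\Diamond\}}[\{p\}]$, $\mathrm{ML}_{\{\mathsf{oxor},\Box\}}[\{p\}]$, $\mathrm{ML}_{\{\mathsf{aimp},\Diamond\}}[\{p\}]$, $\mathrm{ML}_{\{\mathsf{aimp},\Box\}}[\{p\}]$ admits finite characterizations. In fact, in each of these fragments, the atomic formula $p$ is not uniquely characterized with respect to that fragment by any finite set of labeled examples.
   Context: Boolean functions: $\mathsf{3xor}(x,y,z)=x\oplus y\oplus z$, $\mathsf{oxor}(x,y,z)=x\lor(y\oplus z)$, $\mathsf{aimp}(x,y,z)=x\land(y\to z)$. $\mathrm{ML}_{\{f,\Diamond\}}[\{p\}]$ (resp. $\{f,\Box\}$) is the set of modal formulas over the single variable $p$ built using only the ternary connective $f$ (given by a propositional formula defining it) and $\Diamond$ (resp. $\Box$), interpreted over Kripke models. A labeled example is $(M,w,\mathrm{lab})$ with $M$ a finite Kripke model, $w$ a world, $\mathrm{lab}\in\{0,1\}$; $\phi$ fits it if $M,w\models\phi$ iff $\mathrm{lab}=1$. A set $E$ uniquely characterizes $\phi$ with respect to a fragment $L$ if $\phi$ fits $E$ and every formula of $L$ fitting $E$ is $\mathbf{K}$-equivalent (equivalent over all Kripke models) to $\phi$. A fragment admits finite characterizations if every formula in it is uniquely characterized with respect to it by some finite set of labeled examples. -}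

module Defs where

open import Data.Bool using (Bool; true; false; T; _∧_; _∨_; _xor_; not)
open import Data.Nat using (ℕ)
open import Data.Fin using (Fin)
open import Data.Product using (Σ; Σ-syntax; _×_)
open import Data.List using (List)
open import Data.List.Relation.Unary.All using (All)
open import Relation.Nullary using (¬_)
open import Relation.Binary.PropositionalEquality using (_≡_)
open import Function.Bundles using (_⇔_)

3xor : Bool → Bool → Bool → Bool
3xor x y z = (x xor y) xor z

oxor : Bool → Bool → Bool → Bool
oxor x y z = x ∨ (y xor z)

aimp : Bool → Bool → Bool → Bool
aimp x y z = x ∧ (not y ∨ z)

data Conn : Set where
  c3xor coxor caimp : Conn

⟦_⟧c : Conn → Bool → Bool → Bool → Bool
⟦ c3xor ⟧c = 3xor
⟦ coxor ⟧c = oxor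
⟦ caimp ⟧c = aimp

data Modality : Set where
  dia box : Modality

data Form : Set where
  var  : Form
  conn : Form → Form → Form → Form
  mod  : Form → Form                -- ◇φ or □φ (depending on the fragment)

record Model : Set₁ where
  field
    W : Set
    R : W → W → Set
    V : W → Set

open Model public

Holds : Bool → Set → Set
Holds true  A = A
Holds false A = ¬ A

sat : Conn → Modality → (M : Model) → W M → Form → Set
sat c m M w var = V M w
sat c m M w (conn a b d) =
  Σ[ x ∈ Bool ] Σ[ y ∈ Bool ] Σ[ z ∈ Bool ]
    (T (⟦ c ⟧c x y z) × Holds x (sat c m M w a)
                      × Holds y (sat c m M w b)
                      × Holds z (sat c m M w d))
sat c dia M w (mod a) = Σ[ v ∈ W M ] (R M w v × sat c dia M v a)
sat c box M w (mod a) = (v : W M) → R M w v → sat c box M v a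

KEquiv : Conn → Modality → Form → Form → Set₁
KEquiv c m φ ψ = (M : Model) (w : W M) → sat c m M w φ ⇔ sat c m M w ψ

record FinModel : Set where
  field
    size : ℕ
    rel  : Fin size → Fin size → Bool
    val  : Fin size → Bool

toModel : FinModel → Model
toModel F = record
  { W = Fin (FinModel.size F)
  ; R = λ u v → T (FinModel.rel F u v)
  ; V = λ u → T (FinModel.val F u)
  }

record Example : Set where
  field
    model : FinModel
    world : Fin (FinModel.size model)
    label : Bool

FitsEx : Conn → Modality → Form → Example → Set
FitsEx c m φ e =
  sat c m (toModel (Example.model e)) (Example.world e) φ ⇔ (Example.label e ≡ true)

Fits : Conn → Modality → Form → List Example → Set
Fits c m φ E = All (FitsEx c m φ) E

UniquelyCharacterizes : Conn → Modality → List Example → Form → Set₁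
UniquelyCharacterizes c m E φ =
  Fits c m φ E × ((ψ : Form) → Fits c m ψ E → KEquiv c m ψ φ)

AdmitsFiniteCharacterizations : Conn → Modality → Set₁
AdmitsFiniteCharacterizations c m =
  (φ : Form) → Σ[ E ∈ List Example ] UniquelyCharacterizes c m E φ

-- On a finite Kripke model the truth sets of the formulas M^j p (M the modality) form a
-- sequence in a finite set in which each term determines the next, so the sequence is
-- eventually periodic. For a finite set E of examples this yields depths s < t such that
-- M^s p and M^t p agree at every example; as f(x, y, y) = x for each of the three
-- connectives, f(p, M^s p, M^t p) fits E exactly when p does. On the successor chain of
-- ℕ, however, M^s p and M^t p can be given the values ⊤ and ⊥ at the root, and for a
-- suitable value x of p at the root f(x, ⊤, ⊥) ≠ x, so that formula is not K-equivalent
-- to p.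
module Submission where

open import Defs
open import Data.Product using (_×_; ∃₂; _,_; proj₁; proj₂)
open import Data.List using (List; []; _∷_)
open import Relation.Nullary using (¬_)

open import Data.Bool using (Bool; true; false; T; not)
open import Data.Bool.Properties using (not-¬)
open import Data.Empty using (⊥-elim)
open import Data.Nat using (ℕ; zero; suc; _+_; _*_; _∸_; _^_; _<_; _≤ᵇ_)
open import Data.Nat.GeneralisedArithmetic using (fold)
open import Data.Nat.Properties
  using (+-suc; +-identityʳ; +-comm; +-assoc; *-comm; m≤n+m; m∸n+n≡m; n<1+n; ≤-refl; <⇒≱; ≤ᵇ⇒≤; ≤⇒≤ᵇ)
open import Data.Fin using (Fin; toℕ; combine)
open import Data.Fin.Properties using (2↔Bool; combine-injective; pigeonhole; any?; all?)
open import Data.Vec using (Vec; []; _∷_; lookup; tabulate)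
open import Data.Vec.Properties using (lookup∘tabulate; tabulate-cong)
open import Data.List.Relation.Unary.All as All using (All; []; _∷_)
open import Function.Base using (_∘_)
open import Function.Bundles using (_⇔_; mk⇔; _↣_; mk↣; module Equivalence; module Injection)
open import Function.Construct.Composition using (_⇔-∘_)
open import Function.Construct.Identity using (⇔-id)
open import Function.Properties.Inverse using (↔-sym; ↔⇒↣)
open import Relation.Nullary.Decidable
  using (Dec; _because_; does; proof; T?; _×-dec_; _→-dec_; does-⇔)
open import Relation.Nullary.Reflects using (Reflects; ofʸ; ofⁿ; det; fromEquivalence; T-reflects)
open import Relation.Binary.PropositionalEquality
  using (_≡_; refl; sym; cong; cong₂; subst; subst₂; module ≡-Reasoning)

open Equivalence using (to; from)

private
  variable
    A B : Set
    b : Bool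

Reflects-map : A ⇔ B → Reflects A b → Reflects B b
Reflects-map A⇔B (ofʸ a)  = ofʸ (to A⇔B a)
Reflects-map A⇔B (ofⁿ ¬a) = ofⁿ (¬a ∘ from A⇔B)

Reflects⇒⇔ : Reflects A b → Reflects B b → A ⇔ B
Reflects⇒⇔ (ofʸ a)  (ofʸ a′)  = mk⇔ (λ _ → a′) (λ _ → a)
Reflects⇒⇔ (ofⁿ ¬a) (ofⁿ ¬a′) = mk⇔ (⊥-elim ∘ ¬a) (⊥-elim ∘ ¬a′)

Reflects⇒Holds : Reflects A b → Holds b A
Reflects⇒Holds (ofʸ a)  = a
Reflects⇒Holds (ofⁿ ¬a) = ¬a

Holds-unique : ∀ x → Holds x A → Reflects A b → x ≡ b
Holds-unique true  a  = det (ofʸ a)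
Holds-unique false ¬a = det (ofⁿ ¬a)

⟦⟧-diagonal : ∀ c x y → ⟦ c ⟧c x y y ≡ x
⟦⟧-diagonal c3xor false false = refl
⟦⟧-diagonal c3xor false true  = refl
⟦⟧-diagonal c3xor true  false = refl
⟦⟧-diagonal c3xor true  true  = refl
⟦⟧-diagonal coxor false false = refl
⟦⟧-diagonal coxor false true  = refl
⟦⟧-diagonal coxor true  false = refl
⟦⟧-diagonal coxor true  true  = refl
⟦⟧-diagonal caimp false false = refl
⟦⟧-diagonal caimp false true  = refl
⟦⟧-diagonal caimp true  false = refl
⟦⟧-diagonal caimp true  true  = refl

flipPoint : Conn → Bool
flipPoint c3xor = false
flipPoint coxor = false
flipPoint caimp = true

⟦⟧-flips : ∀ c → ⟦ c ⟧c (flipPoint c) true false ≡ not (flipPoint c)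
⟦⟧-flips c3xor = refl
⟦⟧-flips coxor = refl
⟦⟧-flips caimp = refl

module _ (c : Conn) (m : Modality) (M : Model) (w : W M) where

  conn-reflects : ∀ φ ψ χ {x y z} →
    Reflects (sat c m M w φ) x → Reflects (sat c m M w ψ) y → Reflects (sat c m M w χ) z →
    Reflects (sat c m M w (conn φ ψ χ)) (⟦ c ⟧c x y z)
  conn-reflects φ ψ χ {x} {y} {z} rφ rψ rχ = fromEquivalence
    (λ t → x , y , z , t , Reflects⇒Holds rφ , Reflects⇒Holds rψ , Reflects⇒Holds rχ)
    sound
    where
    sound : sat c m M w (conn φ ψ χ) → T (⟦ c ⟧c x y z)
    sound (x′ , y′ , z′ , t , hφ , hψ , hχ)
      with refl ← Holds-unique x′ hφ rφ | refl ← Holds-unique y′ hψ rψ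
         | refl ← Holds-unique z′ hχ rχ = t

  conn-var-collapses : ∀ φ ψ {x y} → Reflects (V M w) x → Reflects (sat c m M w φ) y →
    (sat c m M w φ ⇔ sat c m M w ψ) → sat c m M w (conn var φ ψ) ⇔ V M w
  conn-var-collapses φ ψ {x} {y} rp rφ φ⇔ψ = Reflects⇒⇔
    (subst (Reflects _) (⟦⟧-diagonal c x y)
      (conn-reflects var φ ψ rp rφ (Reflects-map φ⇔ψ rφ))) rp

  conn-var-separates : ∀ φ ψ {x} → Reflects (V M w) x →
    Reflects (sat c m M w φ) true → Reflects (sat c m M w ψ) false →
    ⟦ c ⟧c x true false ≡ not x → ¬ (sat c m M w (conn var φ ψ) ⇔ V M w)
  conn-var-separates φ ψ rp rφ rψ flips equiv = not-¬ refl (det rp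
    (Reflects-map equiv (subst (Reflects _) flips (conn-reflects var φ ψ rp rφ rψ))))

mod-cong : ∀ c m M {φ ψ} → (∀ u → sat c m M u φ ⇔ sat c m M u ψ) →
  ∀ w → sat c m M w (mod φ) ⇔ sat c m M w (mod ψ)
mod-cong c dia M φ⇔ψ w =
  mk⇔ (λ (u , r , s) → u , r , to (φ⇔ψ u) s) (λ (u , r , s) → u , r , from (φ⇔ψ u) s)
mod-cong c box M φ⇔ψ w =
  mk⇔ (λ s u r → to (φ⇔ψ u) (s u r)) (λ s u r → from (φ⇔ψ u) (s u r))

mod^ : ℕ → Form → Form
mod^ j φ = fold φ mod j

chain : (ℕ → Bool) → Model
chain val = record { W = ℕ ; R = λ i j → j ≡ suc i ; V = T ∘ val }

chain-mod : ∀ c m val i φ → sat c m (chain val) i (mod φ) ⇔ sat c m (chain val) (suc i) φ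
chain-mod c dia val i φ = mk⇔ (λ { (_ , refl , s) → s }) (λ s → suc i , refl , s)
chain-mod c box val i φ = mk⇔ (λ s → s (suc i) refl) (λ { s _ refl → s })

chain-mod^ : ∀ c m val j i φ → sat c m (chain val) i (mod^ j φ) ⇔ sat c m (chain val) (i + j) φ
chain-mod^ c m val zero    i φ rewrite +-identityʳ i = ⇔-id _
chain-mod^ c m val (suc j) i φ rewrite +-suc i j =
  chain-mod^ c m val j (suc i) φ ⇔-∘ chain-mod c m val i (mod^ j φ)

plateau : Bool → ℕ → ℕ → Bool
plateau x s zero    = x
plateau x s (suc i) = i ≤ᵇ s

conn-var-mod^-≉-var : ∀ c m {s t} → s < t →
  ¬ KEquiv c m (conn var (mod^ (suc s) var) (mod^ (suc t) var)) var
conn-var-mod^-≉-var c m {s} {t} s<t equiv =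
  conn-var-separates c m (chain val) 0 (mod^ (suc s) var) (mod^ (suc t) var)
    (T-reflects _) shallow deep (⟦⟧-flips c) (equiv (chain val) 0)
  where
  val = plateau (flipPoint c) s
  shallow : Reflects (sat c m (chain val) 0 (mod^ (suc s) var)) true
  shallow = ofʸ (from (chain-mod^ c m val (suc s) 0 var) (≤⇒≤ᵇ (≤-refl {s})))
  deep : Reflects (sat c m (chain val) 0 (mod^ (suc t) var)) false
  deep = ofⁿ (λ h → <⇒≱ s<t (≤ᵇ⇒≤ t s (to (chain-mod^ c m val (suc t) 0 var) h)))

module _ {ℓ} {S : Set ℓ} where

  SuccessorDetermined : (ℕ → S) → Set ℓ
  SuccessorDetermined f = ∀ {i j} → f i ≡ f j → f (suc i) ≡ f (suc j)

  record Period (f : ℕ → S) (a d : ℕ) : Set ℓ where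
    constructor period
    field repeats : ∀ c → f (d + (c + a)) ≡ f (c + a)
  open Period public

  module _ {f : ℕ → S} {a d : ℕ} where

    repetition⇒period : SuccessorDetermined f → f (d + a) ≡ f a → Period f a d
    repetition⇒period det-f rep = period repeats-from
      where
      repeats-from : ∀ c → f (d + (c + a)) ≡ f (c + a)
      repeats-from zero = rep
      repeats-from (suc c) rewrite +-suc d (c + a) = det-f (repeats-from c)

    period-delay : ∀ b → Period f a d → Period f (b + a) d
    period-delay b p = period λ c →
      subst (λ n → f (d + n) ≡ f n) (+-assoc c b a) (repeats p (c + b))

    period-multiple : Period f a d → ∀ k → Period f a (k * d)
    period-multiple p zero    = period λ c → refl
    period-multiple p (suc k) = period λ c → begin
      f ((d + k * d) + (c + a)) ≡⟨ cong f (+-assoc d (k * d) (c + a)) ⟩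
      f (d + (k * d + (c + a))) ≡⟨ repeats (period-delay c p) (k * d) ⟩
      f (k * d + (c + a))       ≡⟨ repeats (period-multiple p k) c ⟩
      f (c + a)                 ∎
      where open ≡-Reasoning

  sequence-repeats : ∀ {n} → S ↣ Fin n → (f : ℕ → S) → ∃₂ λ a d → f (suc d + a) ≡ f a
  sequence-repeats {n} ι f
    with i , j , i<j , same-code ← pigeonhole (n<1+n n) (Injection.to ι ∘ f ∘ toℕ) =
    toℕ i , gap , (begin
      f (suc (gap + toℕ i)) ≡⟨ cong f (+-suc gap (toℕ i)) ⟨
      f (gap + suc (toℕ i)) ≡⟨ cong f (m∸n+n≡m i<j) ⟩
      f (toℕ j)             ≡⟨ Injection.injective ι same-code ⟨
      f (toℕ i)             ∎)
    where
    gap = toℕ j ∸ suc (toℕ i)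
    open ≡-Reasoning

common-period : ∀ {I : Set} {S : I → Set} (f : (i : I) → ℕ → S i) →
  (∀ i → ∃₂ λ a d → Period (f i) a (suc d)) →
  ∀ is → ∃₂ λ a d → All (λ i → Period (f i) a (suc d)) is
common-period f periodic [] = 0 , 0 , []
common-period f periodic (i ∷ is)
  with aᵢ , dᵢ , pᵢ ← periodic i | a , d , ps ← common-period f periodic is =
  aᵢ + a , d + dᵢ * suc d ,
  subst₂ (Period (f i)) (+-comm a aᵢ) (*-comm (suc d) (suc dᵢ))
    (period-multiple (period-delay a pᵢ) (suc d)) ∷
  All.map (λ p → period-multiple (period-delay aᵢ p) (suc dᵢ)) ps

Vec-Bool↣Fin : ∀ n → Vec Bool n ↣ Fin (2 ^ n)
Vec-Bool↣Fin n = mk↣ (encode-injective _ _)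
  where
  bit : Bool ↣ Fin 2
  bit = ↔⇒↣ (↔-sym 2↔Bool)
  encode : ∀ {n} → Vec Bool n → Fin (2 ^ n)
  encode []       = Fin.zero
  encode (b ∷ bs) = combine (Injection.to bit b) (encode bs)
  encode-injective : ∀ {n} (u v : Vec Bool n) → encode u ≡ encode v → u ≡ v
  encode-injective [] [] _ = refl
  encode-injective (b ∷ bs) (b′ ∷ bs′) eq
    with bit≡ , rest≡ ← combine-injective _ _ _ _ eq
    = cong₂ _∷_ (Injection.injective bit bit≡) (encode-injective bs bs′ rest≡)

sat? : ∀ c m F φ (w : Fin (FinModel.size F)) → Dec (sat c m (toModel F) w φ)
sat? c m F var w = T? (FinModel.val F w)
sat? c m F (conn φ ψ χ) w =
  _ because conn-reflects c m (toModel F) w φ ψ χ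
              (proof (sat? c m F φ w)) (proof (sat? c m F ψ w)) (proof (sat? c m F χ w))
sat? c dia F (mod φ) w = any? λ u → T? (FinModel.rel F w u) ×-dec sat? c dia F φ u
sat? c box F (mod φ) w = all? λ u → T? (FinModel.rel F w u) →-dec sat? c box F φ u

module _ (c : Conn) (m : Modality) (F : FinModel) where
  open FinModel F

  truths : Form → Vec Bool size
  truths φ = tabulate (does ∘ sat? c m F φ)

  truths-≡⇒⇔ : ∀ φ ψ → truths φ ≡ truths ψ →
    ∀ w → sat c m (toModel F) w φ ⇔ sat c m (toModel F) w ψ
  truths-≡⇒⇔ φ ψ eq w = Reflects⇒⇔ (proof (sat? c m F φ w))
    (subst (Reflects _) (sym same-does) (proof (sat? c m F ψ w)))
    where
    same-does : does (sat? c m F φ w) ≡ does (sat? c m F ψ w)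
    same-does = begin
      does (sat? c m F φ w)  ≡⟨ lookup∘tabulate _ w ⟨
      lookup (truths φ) w    ≡⟨ cong (λ v → lookup v w) eq ⟩
      lookup (truths ψ) w    ≡⟨ lookup∘tabulate _ w ⟩
      does (sat? c m F ψ w)  ∎
      where open ≡-Reasoning

  truths-mod-cong : ∀ {φ ψ} → truths φ ≡ truths ψ → truths (mod φ) ≡ truths (mod ψ)
  truths-mod-cong {φ} {ψ} eq = tabulate-cong λ w →
    does-⇔ (mod-cong c m (toModel F) {φ} {ψ} (truths-≡⇒⇔ φ ψ eq) w)
           (sat? c m F (mod φ) w) (sat? c m F (mod ψ) w)

  depth-truths : ℕ → Vec Bool size
  depth-truths j = truths (mod^ j var)

  depth-truths-eventually-periodic : ∃₂ λ a d → Period depth-truths a (suc d)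
  depth-truths-eventually-periodic
    with a , d , rep ← sequence-repeats (Vec-Bool↣Fin size) depth-truths =
    a , d , repetition⇒period truths-mod-cong rep

conn-var-fits : ∀ c m φ ψ e →
  truths c m (Example.model e) φ ≡ truths c m (Example.model e) ψ →
  FitsEx c m var e → FitsEx c m (conn var φ ψ) e
conn-var-fits c m φ ψ e eq var-fits = var-fits ⇔-∘
  conn-var-collapses c m (toModel F) w φ ψ
    (T-reflects _) (proof (sat? c m F φ w)) (truths-≡⇒⇔ c m F φ ψ eq w)
  where
  F = Example.model e
  w = Example.world e

var-not-characterized : ∀ c m E → ¬ UniquelyCharacterizes c m E var
var-not-characterized c m E (var-fits , unique)
  with a , d , periods ← common-period (depth-truths c m ∘ Example.model)
                           (depth-truths-eventually-periodic c m ∘ Example.model) E =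
  conn-var-mod^-≉-var c m (m≤n+m (suc a) d) (unique (conn var shallow deep) ψ-fits)
  where
  shallow deep : Form
  shallow = mod^ (suc a) var
  deep    = mod^ (suc d + suc a) var
  ψ-fits : Fits c m (conn var shallow deep) E
  ψ-fits = All.zipWith
    (λ {e} (p , fits) → conn-var-fits c m shallow deep e (sym (repeats p 1)) fits)
    (periods , var-fits)

propositionB5 : (c : Conn) (m : Modality) →
    ¬ AdmitsFiniteCharacterizations c m
      × ((E : List Example) → ¬ UniquelyCharacterizes c m E var)
propositionB5 c m =
  (λ admits → var-not-characterized c m (proj₁ (admits var)) (proj₂ (admits var))) ,
  var-not-characterized c m
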